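{- Assume the setting described in the context. Then every vertex $v\in V(G)$ satisfies $$\mathbb E[R_v] = \left(1 - \frac{p}{\Lambda}\right)^{DC}\Lambda.$$ Moreover, for every $i \in [m]$, $v \in V(G_i)$, and $c \in L(v)$, $$\mathbb E[U_{v, c, i}] = p\left(1 - \left(1 - \frac{p}{\Lambda}\right)^{DC}\right)D \quad\text{and}\quad \mathbb E[K_{v, c, i}] = (1 - p)\left(1 - \frac{p}{\Lambda}\right)^{D(C - 1)}D.$$
   Context: Setting: $C, \Lambda, D$ are positive integers and $0\le p\le 1$. $G_1,\dots,G_m$ are finite nearly disjoint graphs (every two share at most one vertex), $G=\bigcup_{i=1}^m G_i$ (vertex set $\bigcup_i V(G_i)$, edge set $\bigcup_i E(G_i)$), every vertex of $G$ lies in exactly $C$ of the graphs $G_i$, and $L$ is a list assignment for $G$ with $|L(v)|=\Lambda$ for all $v$ and $|\{u\in N_{G_i}(v): c\in L(u)\}| = D$ for every $i\in[m]$, $v\in V(G_i)$, $c\in L(v)$. A random pair $(A,\psi)$: each vertex is in $A$ independently with probability $p$, and independently $\psi(v)\in L(v)$ is uniform for each $v$. Let $L_{A,\psi}(v)\coloneqq L(v)\setminus\{\psi(u): u\in N_G(v)\cap A\}$ and $X_{A,\psi}\coloneqq\{v\in A: \psi(v)\in L_{A,\psi}(v)\}$. Random variables: $R_v\coloneqq |L_{A,\psi}(v)|$; $U_{v,c,i}\coloneqq |\{u\in N_{G_i}(v)\cap A: c\in L(u)\}\setminus X_{A,\psi}|$; $K_{v,c,i}\coloneqq \left|\{u\in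 N_{G_i}(v)\setminus A: c\in L(u)\}\setminus \bigcup_{w\in A\setminus V(G_i):\, \psi(w)=c} N_G(w)\right|$.
   Formalization: The parameter p is a rational number with $0\le p\le 1$. -}

module Defs where

open import Data.Nat as ℕ using (ℕ; zero; suc; NonZero)
open import Data.Nat.Base using (_≡ᵇ_)
open import Data.Fin using (Fin; zero; suc)
open import Data.Bool using (Bool; true; false; _∧_; _∨_; not; if_then_else_)
open import Data.List using (List; []; _∷_; concatMap; map)
open import Data.Integer using (+_)
open import Data.Rational as ℚ using (ℚ; 0ℚ; 1ℚ; _+_; _*_; _-_)
open import Relation.Binary.PropositionalEquality using (_≡_; _≢_)

count : (k : ℕ) → (Fin k → Bool) → ℕ
count zero    P = 0
count (suc k) P = (if P zero then 1 else 0) ℕ.+ count k (λ i → P (suc i))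

anyFin : (k : ℕ) → (Fin k → Bool) → Bool
anyFin zero    P = false
anyFin (suc k) P = P zero ∨ anyFin k (λ i → P (suc i))

_^ℚ_ : ℚ → ℕ → ℚ
q ^ℚ zero  = 1ℚ
q ^ℚ suc k = q * (q ^ℚ k)

cons : {X : Set} {n : ℕ} → X → (Fin n → X) → Fin (suc n) → X
cons x f zero    = x
cons x f (suc i) = f i

allFuns : {X : Set} → List X → (n : ℕ) → List (Fin n → X)
allFuns xs zero    = (λ ()) ∷ []
allFuns xs (suc n) = concatMap (λ x → map (cons x) (allFuns xs n)) xs

allFinList : (k : ℕ) → List (Fin k)
allFinList zero    = []
allFinList (suc k) = zero ∷ map suc (allFinList k)

sumℚ : List ℚ → ℚ
sumℚ []       = 0ℚ
sumℚ (x ∷ xs) = x + sumℚ xs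

prodFin : (k : ℕ) → (Fin k → ℚ) → ℚ
prodFin zero    f = 1ℚ
prodFin (suc k) f = f zero * prodFin k (λ i → f (suc i))

-- Vertices of G are Fin n; the graphs G_1..G_m are indexed by Fin m.
-- inG i v  : v ∈ V(G_i);   adj i u v : uv ∈ E(G_i).
-- Lists: L v : Fin Λ → ℕ enumerates L(v) (injective, so |L(v)| = Λ);
-- colours are natural numbers.

record Setting (n m C Λ D : ℕ) : Set where
  field
    inG : Fin m → Fin n → Bool
    adj : Fin m → Fin n → Fin n → Bool
    L   : Fin n → Fin Λ → ℕ
    adj-sym   : ∀ i u v → adj i u v ≡ adj i v u
    adj-irr   : ∀ i v → adj i v v ≡ false
    adj-inG   : ∀ i u v → adj i u v ≡ true → inG i u ≡ true
    nearly-disjoint : ∀ i j → i ≢ j → ∀ u v →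
      inG i u ≡ true → inG j u ≡ true → inG i v ≡ true → inG j v ≡ true → u ≡ v
    -- every vertex lies in exactly C of the G_i (so V(G) = ⋃ V(G_i) when C ≥ 1)
    degC : ∀ v → count m (λ i → inG i v) ≡ C
    L-inj : ∀ v k k' → L v k ≡ L v k' → k ≡ k'

  inL : Fin n → ℕ → Bool
  inL u c = anyFin Λ (λ k → L u k ≡ᵇ c)

  adjG : Fin n → Fin n → Bool
  adjG u v = anyFin m (λ i → adj i u v)

record ValidSetting (n m C Λ D : ℕ) : Set where
  field
    S : Setting n m C Λ D
  open Setting S public
  field
    degD : ∀ i v k → inG i v ≡ true →
      count n (λ u → adj i v u ∧ inL u (L v k)) ≡ D

-- Random variables, for a fixed outcome (A, ψ) with A : Fin n → Bool and
-- ψ : Fin n → Fin Λ (ψ(v) is the colour L v (ψ v)).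

module RV {n m C Λ D : ℕ} (S : Setting n m C Λ D)
          (A : Fin n → Bool) (ψ : Fin n → Fin Λ) where
  open Setting S

  col : Fin n → ℕ
  col v = L v (ψ v)

  inLA : Fin n → ℕ → Bool
  inLA v c = inL v c ∧ not (anyFin n (λ u → adjG u v ∧ A u ∧ (col u ≡ᵇ c)))

  inX : Fin n → Bool
  inX v = A v ∧ inLA v (col v)

  R : Fin n → ℕ
  R v = count Λ (λ k → inLA v (L v k))

  U : Fin n → ℕ → Fin m → ℕ
  U v c i = count n (λ u → adj i v u ∧ A u ∧ inL u c ∧ not (inX u))

  K : Fin n → ℕ → Fin m → ℕ
  K v c i = count n (λ u → adj i v u ∧ not (A u) ∧ inL u c ∧
              not (anyFin n (λ w → A w ∧ not (inG i w) ∧ (col w ≡ᵇ c) ∧ adjG w u)))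

-- Expectation over the finite probability space:
-- A has each vertex independently with probability p,
-- ψ(v) uniform in L(v) independently.

bools : List Bool
bools = false ∷ true ∷ []

weightA : (n : ℕ) → ℚ → (Fin n → Bool) → ℚ
weightA n p A = prodFin n (λ v → if A v then p else (1ℚ - p))

expect : (n Λ : ℕ) .{{_ : NonZero Λ}} → ℚ →
         ((Fin n → Bool) → (Fin n → Fin Λ) → ℕ) → ℚ
expect n Λ p F =
  sumℚ (map (λ A → sumℚ (map (λ ψ →
      weightA n p A * ((((+ 1) ℚ./ Λ) ^ℚ n) * ((+ F A ψ) ℚ./ 1)))
    (allFuns (allFinList Λ) n)))
    (allFuns bools n))

fromℕ : ℕ → ℚ
fromℕ k = (+ k) ℚ./ 1

-- Under the product measure, "no vertex of B is activated with colour c" is an intersection of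
-- independent per-vertex events. A vertex w ∈ B with c ∈ L(w) violates it exactly when w ∈ A and
-- ψ(w) is the unique index of c, which has probability p/Λ; so the event has probability
-- q^|{w ∈ B : c ∈ L(w)}| with q = 1 − p/Λ. Near-disjointness makes the neighbourhoods N_{G_i}(u)
-- disjoint, so u has DC neighbours with c in their lists, D(C − 1) of them outside a given G_i ∋ u.
-- Linearity over the Λ colours of v gives E[R_v]. For U and K sum over the D vertices
-- u ∈ N_{G_i}(v) with c ∈ L(u): an activated u keeps its own colour (condition on ψ(u)) with
-- probability q^{DC}, and a non-activated u is unblocked by A ∖ V(G_i) with probability q^{D(C−1)}.

module Submission where

open import Algebra.Bundles using (CommutativeMonoid; Ring)
import Algebra.Properties.CommutativeSemigroup as CommutativeSemigroupProperties
open import Data.Bool using (Bool; true; false; _∧_; _∨_; not; if_then_else_)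
open import Data.Bool.Properties
  using (∧-commutativeMonoid; ∧-assoc; ∧-zeroʳ; ∧-conicalˡ; ∧-conicalʳ; ¬-not; not-¬; T-≡)
open import Data.Empty using (⊥-elim)
open import Data.Fin using (Fin; zero; suc)
open import Data.Fin.Properties using (_≟_; suc-injective; 0≢1+n)
open import Data.Integer using (+_)
open import Data.Integer.Properties using (+◃n≡+n)
open import Data.List using (List; []; _∷_; _++_; map; concatMap)
open import Data.Nat using (ℕ; NonZero; _≤_; zero; suc; _∸_; _≡ᵇ_)
import Data.Nat as ℕ
import Data.Nat.Properties as ℕP
open import Data.Nat.Coprimality using (1-coprimeTo) renaming (sym to coprime-sym)
open import Data.Product using (_×_; ∃; _,_; proj₂)
open import Data.Rational using (ℚ; 0ℚ; 1ℚ; mkℚ; _+_; _*_; _-_; -_; _/_) renaming (_≤_ to _≤ℚ_)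
open import Data.Rational.Properties
  using ( normalize-coprime; *-inverseˡ; +-*-ring; *-1-commutativeMonoid; +-identityˡ; +-identityʳ; +-assoc
        ; *-zeroˡ; *-zeroʳ; *-identityˡ; *-identityʳ; *-distribˡ-+; *-assoc; *-comm)
open import Data.Rational.Solver using (module +-*-Solver)
open import Function.Bundles using (Equivalence)
open import Relation.Binary.PropositionalEquality
  using (_≡_; _≢_; refl; sym; trans; subst; cong; cong₂; module ≡-Reasoning)
open import Relation.Nullary using (does; yes; no)

open import Defs

open import Algebra.Properties.Semiring.Sum (Ring.semiring +-*-ring)
  using (sum-syntax; sum-cong-≗; *-distribʳ-sum; sum-replicate-zero)
open CommutativeSemigroupProperties (CommutativeMonoid.commutativeSemigroup ∧-commutativeMonoid)
  using ()
  renaming (interchange to ∧-interchange; xy∙z≈y∙xz to xy∧z≡y∧xz; x∙yz≈xz∙y to x∧yz≡xz∧y; x∙yz≈y∙xz to x∧yz≡y∧xz)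
open CommutativeSemigroupProperties (CommutativeMonoid.commutativeSemigroup *-1-commutativeMonoid)
  using () renaming (x∙yz≈y∙zx to x*yz≡y*zx)
open +-*-Solver

fromℕ-mkℚ : ∀ k → fromℕ k ≡ mkℚ (+ k) 0 (coprime-sym (1-coprimeTo k))
fromℕ-mkℚ k = normalize-coprime (coprime-sym (1-coprimeTo k))

fromℕ-suc : ∀ k → fromℕ (suc k) ≡ 1ℚ + fromℕ k
fromℕ-suc k rewrite fromℕ-mkℚ k | ℕP.*-identityʳ k | +◃n≡+n k = refl

1/n*n≡1 : ∀ n .{{_ : NonZero n}} → (+ 1) / n * fromℕ n ≡ 1ℚ
1/n*n≡1 (suc d) rewrite fromℕ-mkℚ (suc d) | normalize-coprime {1} {d} (1-coprimeTo (suc d)) =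
  *-inverseˡ (mkℚ (+ suc d) 0 (coprime-sym (1-coprimeTo (suc d))))

≡ᵇ-true⇒≡ : ∀ {a b} → (a ≡ᵇ b) ≡ true → a ≡ b
≡ᵇ-true⇒≡ {a} {b} e = ℕP.≡ᵇ⇒≡ a b (Equivalence.from T-≡ e)

≡ᵇ-refl : ∀ a → (a ≡ᵇ a) ≡ true
≡ᵇ-refl a = Equivalence.to T-≡ (ℕP.≡⇒≡ᵇ a a refl)

∧-regroup : ∀ a x b y → a ∧ (x ∧ (b ∧ y)) ≡ (a ∧ b) ∧ (x ∧ y)
∧-regroup a x b y = trans (sym (∧-assoc a x (b ∧ y))) (∧-interchange a x b y)

𝟙 : Bool → ℚ
𝟙 true  = 1ℚ
𝟙 false = 0ℚ

𝟙-∧ : ∀ a b → 𝟙 (a ∧ b) ≡ 𝟙 a * 𝟙 b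
𝟙-∧ true  b = sym (*-identityˡ (𝟙 b))
𝟙-∧ false b = sym (*-zeroˡ (𝟙 b))

𝟙-not : ∀ a → 𝟙 (not a) ≡ 1ℚ - 𝟙 a
𝟙-not true  = refl
𝟙-not false = refl

𝟙-∧-not-∧ : ∀ a b → 𝟙 (a ∧ not (a ∧ b)) ≡ 𝟙 a + (- 1ℚ) * (𝟙 a * 𝟙 b)
𝟙-∧-not-∧ true  b =
  trans (𝟙-not b) (solve 1 (λ x → con 1ℚ :- x := con 1ℚ :+ con (- 1ℚ) :* (con 1ℚ :* x)) refl (𝟙 b))
𝟙-∧-not-∧ false b = solve 1 (λ x → con 0ℚ := con 0ℚ :+ con (- 1ℚ) :* (con 0ℚ :* x)) refl (𝟙 b)

𝟙-not-anyFin : ∀ k (P : Fin k → Bool) → 𝟙 (not (anyFin k P)) ≡ prodFin k (λ i → 𝟙 (not (P i)))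
𝟙-not-anyFin zero    P = refl
𝟙-not-anyFin (suc k) P with P zero
... | true  = sym (*-zeroˡ (prodFin k (λ i → 𝟙 (not (P (suc i))))))
... | false = trans (𝟙-not-anyFin k (λ i → P (suc i))) (sym (*-identityˡ (prodFin k (λ i → 𝟙 (not (P (suc i)))))))

∑-𝟙 : ∀ k (P : Fin k → Bool) → ∑[ i < k ] 𝟙 (P i) ≡ fromℕ (count k P)
∑-𝟙 zero    P = refl
∑-𝟙 (suc k) P with P zero
... | true  = trans (cong (λ x → 1ℚ + x) (∑-𝟙 k (λ i → P (suc i)))) (sym (fromℕ-suc (count k (λ i → P (suc i)))))
... | false = trans (+-identityˡ (∑[ i < k ] 𝟙 (P (suc i)))) (∑-𝟙 k (λ i → P (suc i)))

∑-const : ∀ k c → ∑[ i < k ] c ≡ fromℕ k * c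
∑-const zero    c = sym (*-zeroˡ c)
∑-const (suc k) c rewrite ∑-const k c | fromℕ-suc k = solve 2 (λ c K → c :+ K :* c := (con 1ℚ :+ K) :* c) refl c (fromℕ k)

∑-δ : ∀ k (j : Fin k) (h : Fin k → ℚ) → ∑[ i < k ] (𝟙 (does (j ≟ i)) * h i) ≡ h j
∑-δ (suc k) zero    h = trans (cong₂ _+_ (*-identityˡ (h zero)) (trans (sum-cong-≗ {k} (λ i → *-zeroˡ (h (suc i))))
                                                                  (sum-replicate-zero k)))
                              (+-identityʳ (h zero))
∑-δ (suc k) (suc j) h = trans (cong₂ _+_ (*-zeroˡ (h zero)) (∑-δ k j (λ i → h (suc i)))) (+-identityˡ (h (suc j)))

∑-𝟙-not : ∀ k (P : Fin k → Bool) → ∑[ i < k ] 𝟙 (not (P i)) ≡ fromℕ k - fromℕ (count k P)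
∑-𝟙-not zero    P = refl
∑-𝟙-not (suc k) P with P zero
... | true  rewrite ∑-𝟙-not k (λ i → P (suc i)) | fromℕ-suc k | fromℕ-suc (count k (λ i → P (suc i))) =
  solve 2 (λ K C → con 0ℚ :+ (K :- C) := (con 1ℚ :+ K) :- (con 1ℚ :+ C)) refl
    (fromℕ k) (fromℕ (count k (λ i → P (suc i))))
... | false rewrite ∑-𝟙-not k (λ i → P (suc i)) | fromℕ-suc k =
  solve 2 (λ K C → con 1ℚ :+ (K :- C) := (con 1ℚ :+ K) :- C) refl
    (fromℕ k) (fromℕ (count k (λ i → P (suc i))))

does-≟-comm : ∀ {k} (i j : Fin k) → does (i ≟ j) ≡ does (j ≟ i)
does-≟-comm i j with i ≟ j | j ≟ i
... | yes _   | yes _   = refl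
... | no  _   | no  _   = refl
... | yes i≡j | no  j≢i = ⊥-elim (j≢i (sym i≡j))
... | no  i≢j | yes j≡i = ⊥-elim (i≢j (sym j≡i))

prodFin-cong : ∀ k {f g : Fin k → ℚ} → (∀ i → f i ≡ g i) → prodFin k f ≡ prodFin k g
prodFin-cong zero    f≗g = refl
prodFin-cong (suc k) f≗g = cong₂ _*_ (f≗g zero) (prodFin-cong k (λ i → f≗g (suc i)))

prodFin-1 : ∀ k → prodFin k (λ _ → 1ℚ) ≡ 1ℚ
prodFin-1 zero    = refl
prodFin-1 (suc k) = trans (*-identityˡ _) (prodFin-1 k)

prodFin-^ : ∀ k (P : Fin k → Bool) x → prodFin k (λ i → if P i then x else 1ℚ) ≡ x ^ℚ count k P
prodFin-^ zero    P x = refl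
prodFin-^ (suc k) P x with P zero
... | true  = cong (x *_) (prodFin-^ k (λ i → P (suc i)) x)
... | false = trans (*-identityˡ _) (prodFin-^ k (λ i → P (suc i)) x)

prodFin-update : ∀ k (j : Fin k) (f g : Fin k → ℚ) → f j ≡ 1ℚ →
  prodFin k (λ i → if does (i ≟ j) then g i else f i) ≡ g j * prodFin k f
prodFin-update (suc k) zero f g fj≡1 rewrite fj≡1 =
  cong (g zero *_) (sym (*-identityˡ (prodFin k (λ i → f (suc i)))))
prodFin-update (suc k) (suc j) f g fj≡1
  rewrite prodFin-update k j (λ i → f (suc i)) (λ i → g (suc i)) fj≡1 =
  solve 3 (λ a b c → a :* (b :* c) := b :* (a :* c)) refl (f zero) (g (suc j)) (prodFin k (λ i → f (suc i)))

count-cong : ∀ k {P Q : Fin k → Bool} → (∀ i → P i ≡ Q i) → count k P ≡ count k Q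
count-cong zero    P≗Q = refl
count-cong (suc k) {Q = Q} P≗Q rewrite P≗Q zero = cong ((if Q zero then 1 else 0) ℕ.+_) (count-cong k (λ i → P≗Q (suc i)))

count-all : ∀ k (P : Fin k → Bool) → (∀ i → P i ≡ true) → count k P ≡ k
count-all zero    P all = refl
count-all (suc k) P all rewrite all zero = cong suc (count-all k (λ i → P (suc i)) (λ i → all (suc i)))

count-none : ∀ k (P : Fin k → Bool) → (∀ i → P i ≡ false) → count k P ≡ 0
count-none zero    P none = refl
count-none (suc k) P none rewrite none zero = count-none k (λ i → P (suc i)) (λ i → none (suc i))

anyFin-witness : ∀ k (P : Fin k → Bool) → anyFin k P ≡ true → ∃ λ i → P i ≡ true
anyFin-witness (suc k) P any with P zero in e
... | true  = zero , e
... | false with anyFin-witness k (λ i → P (suc i)) any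
...   | i , Pi = suc i , Pi

anyFin-intro : ∀ k (P : Fin k → Bool) i → P i ≡ true → anyFin k P ≡ true
anyFin-intro (suc k) P zero    Pi rewrite Pi = refl
anyFin-intro (suc k) P (suc i) Pi with P zero
... | true  = refl
... | false = anyFin-intro k (λ j → P (suc j)) i Pi

anyFin-cong : ∀ k {P Q : Fin k → Bool} → (∀ i → P i ≡ Q i) → anyFin k P ≡ anyFin k Q
anyFin-cong zero    P≗Q = refl
anyFin-cong (suc k) P≗Q = cong₂ _∨_ (P≗Q zero) (anyFin-cong k (λ i → P≗Q (suc i)))

anyFin-∧ʳ : ∀ k (P : Fin k → Bool) b → anyFin k P ∧ b ≡ anyFin k (λ i → P i ∧ b)
anyFin-∧ʳ zero    P b = refl
anyFin-∧ʳ (suc k) P b with P zero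
... | false = anyFin-∧ʳ k (λ i → P (suc i)) b
... | true with b
...   | true  = refl
...   | false = trans (sym (∧-zeroʳ (anyFin k (λ i → P (suc i))))) (anyFin-∧ʳ k (λ i → P (suc i)) false)

AtMostOne : ∀ {k} → (Fin k → Bool) → Set
AtMostOne P = ∀ {i j} → P i ≡ true → P j ≡ true → i ≡ j

count-atMostOne : ∀ k (P : Fin k → Bool) → AtMostOne P → count k P ≡ (if anyFin k P then 1 else 0)
count-atMostOne zero    P unique = refl
count-atMostOne (suc k) P unique with P zero in P0
... | true  = cong suc (count-none k (λ i → P (suc i)) (λ i → ¬-not (λ Pi → 0≢1+n (unique P0 Pi))))
... | false = count-atMostOne k (λ i → P (suc i)) (λ Pi Pj → suc-injective (unique Pi Pj))

count-∨ : ∀ k (P Q : Fin k → Bool) → (∀ i → P i ≡ true → Q i ≡ false) →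
  count k (λ i → P i ∨ Q i) ≡ count k P ℕ.+ count k Q
count-∨ zero    P Q disjoint = refl
count-∨ (suc k) P Q disjoint
  with P zero in P0 | Q zero in Q0 | count-∨ k (λ i → P (suc i)) (λ i → Q (suc i)) (λ i → disjoint (suc i))
... | true  | true  | _  with () ← trans (sym Q0) (disjoint zero P0)
... | true  | false | IH = cong suc IH
... | false | true  | IH = trans (cong suc IH) (sym (ℕP.+-suc _ _))
... | false | false | IH = IH

count-anyFin : ∀ n m (Q : Fin m → Fin n → Bool) (P : Fin m → Bool) d →
  (∀ w → AtMostOne (λ i → Q i w)) → (∀ i → count n (Q i) ≡ (if P i then d else 0)) →
  count n (λ w → anyFin m (λ i → Q i w)) ≡ d ℕ.* count m P
count-anyFin n zero    Q P d disjoint uniform = trans (count-none n _ (λ _ → refl)) (sym (ℕP.*-zeroʳ d))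
count-anyFin n (suc m) Q P d disjoint uniform = begin
  count n (λ w → Q zero w ∨ anyFin m (λ i → Q (suc i) w))
    ≡⟨ count-∨ n (Q zero) _ (λ w Q0w → ¬-not (λ anyQw → 0≢1+n (disjoint w Q0w (proj₂ (anyFin-witness m _ anyQw))))) ⟩
  count n (Q zero) ℕ.+ count n (λ w → anyFin m (λ i → Q (suc i) w))
    ≡⟨ cong₂ ℕ._+_ (uniform zero) (count-anyFin n m (λ i → Q (suc i)) (λ i → P (suc i)) d
                                     (λ w Qi Qj → suc-injective (disjoint w Qi Qj)) (λ i → uniform (suc i))) ⟩
  (if P zero then d else 0) ℕ.+ d ℕ.* count m (λ i → P (suc i))
    ≡⟨ lemma (P zero) ⟩
  d ℕ.* count (suc m) P ∎
  where
  open ≡-Reasoning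
  lemma : ∀ b → (if b then d else 0) ℕ.+ d ℕ.* count m (λ i → P (suc i))
              ≡ d ℕ.* ((if b then 1 else 0) ℕ.+ count m (λ i → P (suc i)))
  lemma true  = sym (ℕP.*-suc d _)
  lemma false = refl

count-remove : ∀ m (P : Fin m → Bool) i → P i ≡ true →
  count m P ≡ suc (count m (λ j → not (does (j ≟ i)) ∧ P j))
count-remove (suc m) P zero    Pi rewrite Pi = refl
count-remove (suc m) P (suc i) Pi with P zero
... | true  = cong suc (count-remove m (λ j → P (suc j)) i Pi)
... | false = count-remove m (λ j → P (suc j)) i Pi

private variable X Y : Set

sumOver : List X → (X → ℚ) → ℚ
sumOver xs h = sumℚ (map h xs)

sumOver-cong : ∀ (xs : List X) {h h′ : X → ℚ} → (∀ x → h x ≡ h′ x) → sumOver xs h ≡ sumOver xs h′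
sumOver-cong []       h≗h′ = refl
sumOver-cong (x ∷ xs) h≗h′ = cong₂ _+_ (h≗h′ x) (sumOver-cong xs h≗h′)

sumOver-++ : ∀ (xs ys : List X) h → sumOver (xs ++ ys) h ≡ sumOver xs h + sumOver ys h
sumOver-++ []       ys h = sym (+-identityˡ _)
sumOver-++ (x ∷ xs) ys h rewrite sumOver-++ xs ys h = sym (+-assoc (h x) _ _)

sumOver-concatMap : ∀ (xs : List X) (ys : X → List Y) h →
  sumOver (concatMap ys xs) h ≡ sumOver xs (λ x → sumOver (ys x) h)
sumOver-concatMap []       ys h = refl
sumOver-concatMap (x ∷ xs) ys h =
  trans (sumOver-++ (ys x) (concatMap ys xs) h) (cong (λ s → sumOver (ys x) h + s) (sumOver-concatMap xs ys h))

sumOver-map : ∀ (f : Y → X) (ys : List Y) h → sumOver (map f ys) h ≡ sumOver ys (λ y → h (f y))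
sumOver-map f []       h = refl
sumOver-map f (y ∷ ys) h = cong (λ s → h (f y) + s) (sumOver-map f ys h)

*-distribˡ-sumOver : ∀ c (xs : List X) h → c * sumOver xs h ≡ sumOver xs (λ x → c * h x)
*-distribˡ-sumOver c []       h = *-zeroʳ c
*-distribˡ-sumOver c (x ∷ xs) h rewrite sym (*-distribˡ-sumOver c xs h) = *-distribˡ-+ c (h x) _

sumOver-distrib-+ : ∀ (xs : List X) h h′ → sumOver xs (λ x → h x + h′ x) ≡ sumOver xs h + sumOver xs h′
sumOver-distrib-+ []       h h′ = refl
sumOver-distrib-+ (x ∷ xs) h h′ rewrite sumOver-distrib-+ xs h h′ =
  solve 4 (λ a b c d → (a :+ b) :+ (c :+ d) := (a :+ c) :+ (b :+ d)) refl (h x) (h′ x) (sumOver xs h) (sumOver xs h′)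

sumOver-zero : ∀ (xs : List X) → sumOver xs (λ _ → 0ℚ) ≡ 0ℚ
sumOver-zero []       = refl
sumOver-zero (x ∷ xs) = trans (+-identityˡ _) (sumOver-zero xs)

sumOver-comm : ∀ (xs : List X) (ys : List Y) (h : X → Y → ℚ) →
  sumOver xs (λ x → sumOver ys (h x)) ≡ sumOver ys (λ y → sumOver xs (λ x → h x y))
sumOver-comm []       ys h = sym (sumOver-zero ys)
sumOver-comm (x ∷ xs) ys h rewrite sumOver-comm xs ys h = sym (sumOver-distrib-+ ys (h x) (λ y → sumOver xs (λ x′ → h x′ y)))

sumOver-allFuns : ∀ (xs : List X) n (h : (Fin (suc n) → X) → ℚ) →
  sumOver (allFuns xs (suc n)) h ≡ sumOver xs (λ x → sumOver (allFuns xs n) (λ f → h (cons x f)))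
sumOver-allFuns xs n h = trans (sumOver-concatMap xs (λ x → map (cons x) (allFuns xs n)) h)
                               (sumOver-cong xs (λ x → sumOver-map (cons x) (allFuns xs n) h))

sumOver-allFinList : ∀ k (h : Fin k → ℚ) → sumOver (allFinList k) h ≡ ∑[ i < k ] h i
sumOver-allFinList zero    h = refl
sumOver-allFinList (suc k) h =
  cong (λ s → h zero + s) (trans (sumOver-map suc (allFinList k) h) (sumOver-allFinList k (λ i → h (suc i))))

-- For t = 1/Λ, 𝔼 n (λ A ψ → fromℕ (F A ψ)) is definitionally expect n Λ p F;
-- 𝔼₁ is the expectation over a single coordinate (A v, ψ v).
module RandomPair (Λ : ℕ) (p t : ℚ) where

  subsets : ∀ n → List (Fin n → Bool)
  subsets = allFuns bools

  colourings : ∀ n → List (Fin n → Fin Λ)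
  colourings = allFuns (allFinList Λ)

  𝔼 : (n : ℕ) → ((Fin n → Bool) → (Fin n → Fin Λ) → ℚ) → ℚ
  𝔼 n F = sumOver (subsets n) λ A → sumOver (colourings n) λ ψ → weightA n p A * ((t ^ℚ n) * F A ψ)

  𝔼₁ : (Bool → Fin Λ → ℚ) → ℚ
  𝔼₁ h = (1ℚ - p) * (t * ∑[ k < Λ ] h false k) + p * (t * ∑[ k < Λ ] h true k)

  𝔼-cong : ∀ n {F G} → (∀ A ψ → F A ψ ≡ G A ψ) → 𝔼 n F ≡ 𝔼 n G
  𝔼-cong n F≗G = sumOver-cong (subsets n) λ A → sumOver-cong (colourings n) λ ψ →
    cong (λ x → weightA n p A * ((t ^ℚ n) * x)) (F≗G A ψ)

  𝔼-+ : ∀ n F G → 𝔼 n (λ A ψ → F A ψ + G A ψ) ≡ 𝔼 n F + 𝔼 n G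
  𝔼-+ n F G = trans
    (sumOver-cong (subsets n) λ A → trans
      (sumOver-cong (colourings n) λ ψ →
        solve 4 (λ w T a b → w :* (T :* (a :+ b)) := w :* (T :* a) :+ w :* (T :* b)) refl
          (weightA n p A) (t ^ℚ n) (F A ψ) (G A ψ))
      (sumOver-distrib-+ (colourings n) _ _))
    (sumOver-distrib-+ (subsets n) _ _)

  𝔼-*ˡ : ∀ n c F → 𝔼 n (λ A ψ → c * F A ψ) ≡ c * 𝔼 n F
  𝔼-*ˡ n c F = trans
    (sumOver-cong (subsets n) λ A → trans
      (sumOver-cong (colourings n) λ ψ →
        solve 4 (λ w T c a → w :* (T :* (c :* a)) := c :* (w :* (T :* a))) refl
          (weightA n p A) (t ^ℚ n) c (F A ψ))
      (sym (*-distribˡ-sumOver c (colourings n) _)))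
    (sym (*-distribˡ-sumOver c (subsets n) _))

  𝔼-∑ : ∀ n k (F : Fin k → (Fin n → Bool) → (Fin n → Fin Λ) → ℚ) →
    𝔼 n (λ A ψ → ∑[ j < k ] F j A ψ) ≡ ∑[ j < k ] 𝔼 n (F j)
  𝔼-∑ n zero    F = trans (𝔼-*ˡ n 0ℚ (λ _ _ → 0ℚ)) (*-zeroˡ (𝔼 n (λ _ _ → 0ℚ)))
  𝔼-∑ n (suc k) F = trans (𝔼-+ n (F zero) _) (cong (λ x → 𝔼 n (F zero) + x) (𝔼-∑ n k (λ j → F (suc j))))

  𝔼₁-cong : ∀ {h h′ : Bool → Fin Λ → ℚ} → (∀ b k → h b k ≡ h′ b k) → 𝔼₁ h ≡ 𝔼₁ h′
  𝔼₁-cong h≗h′ = cong₂ (λ x y → (1ℚ - p) * (t * x) + p * (t * y))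
    (sum-cong-≗ {Λ} (h≗h′ false)) (sum-cong-≗ {Λ} (h≗h′ true))

  𝔼₁-*ʳ : ∀ h c → 𝔼₁ (λ b k → h b k * c) ≡ 𝔼₁ h * c
  𝔼₁-*ʳ h c rewrite sym (*-distribʳ-sum c (h false)) | sym (*-distribʳ-sum c (h true)) =
    solve 5 (λ p t a b c → (con 1ℚ :- p) :* (t :* (a :* c)) :+ p :* (t :* (b :* c))
                         := ((con 1ℚ :- p) :* (t :* a) :+ p :* (t :* b)) :* c)
      refl p t (∑[ k < Λ ] h false k) (∑[ k < Λ ] h true k) c

  𝔼-suc : ∀ n F → 𝔼 (suc n) F ≡ 𝔼₁ (λ b k → 𝔼 n (λ A ψ → F (cons b A) (cons k ψ)))
  𝔼-suc n F = begin
    𝔼 (suc n) F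
      ≡⟨ sumOver-allFuns bools n (λ A → sumOver (colourings (suc n)) (W A)) ⟩
    sumOver bools (λ b → sumOver (subsets n) λ A → sumOver (colourings (suc n)) λ ψ → W (cons b A) ψ)
      ≡⟨ sumOver-cong bools (λ b → sumOver-cong (subsets n) λ A → sumOver-allFuns ks n (W (cons b A))) ⟩
    sumOver bools (λ b → sumOver (subsets n) λ A → sumOver ks λ k → sumOver (colourings n) λ ψ → W (cons b A) (cons k ψ))
      ≡⟨ sumOver-cong bools (λ b →
           sumOver-comm (subsets n) ks (λ A k → sumOver (colourings n) λ ψ → W (cons b A) (cons k ψ))) ⟩
    sumOver bools (λ b → sumOver ks λ k → sumOver (subsets n) λ A → sumOver (colourings n) λ ψ → W (cons b A) (cons k ψ))
      ≡⟨ sumOver-cong bools (λ b → sumOver-cong ks λ k → factor b k) ⟩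
    sumOver bools (λ b → sumOver ks λ k → weight b * (t * 𝔼 n (F′ b k)))
      ≡⟨ sumOver-cong bools (λ b → trans (sym (*-distribˡ-sumOver (weight b) ks (λ k → t * 𝔼 n (F′ b k))))
           (cong (weight b *_) (trans (sym (*-distribˡ-sumOver t ks (λ k → 𝔼 n (F′ b k))))
             (cong (t *_) (sumOver-allFinList Λ (λ k → 𝔼 n (F′ b k)))))))  ⟩
    (1ℚ - p) * (t * ∑[ k < Λ ] 𝔼 n (F′ false k)) + (p * (t * ∑[ k < Λ ] 𝔼 n (F′ true k)) + 0ℚ)
      ≡⟨ cong (λ x → (1ℚ - p) * (t * ∑[ k < Λ ] 𝔼 n (F′ false k)) + x) (+-identityʳ _) ⟩
    𝔼₁ (λ b k → 𝔼 n (F′ b k)) ∎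
    where
    open ≡-Reasoning
    ks : List (Fin Λ)
    ks = allFinList Λ
    W : (Fin (suc n) → Bool) → (Fin (suc n) → Fin Λ) → ℚ
    W A ψ = weightA (suc n) p A * ((t ^ℚ suc n) * F A ψ)
    F′ : Bool → Fin Λ → (Fin n → Bool) → (Fin n → Fin Λ) → ℚ
    F′ b k A ψ = F (cons b A) (cons k ψ)
    weight : Bool → ℚ
    weight b = if b then p else 1ℚ - p
    factor : ∀ b k → sumOver (subsets n) (λ A → sumOver (colourings n) λ ψ → W (cons b A) (cons k ψ))
                   ≡ weight b * (t * 𝔼 n (F′ b k))
    factor b k = trans
      (sumOver-cong (subsets n) λ A → sumOver-cong (colourings n) λ ψ →
        solve 5 (λ w v t T f → (w :* v) :* ((t :* T) :* f) := (w :* t) :* (v :* (T :* f))) refl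
          (weight b) (weightA n p A) t (t ^ℚ n) (F′ b k A ψ))
      (trans (sumOver-cong (subsets n) λ A → sym (*-distribˡ-sumOver (weight b * t) (colourings n) _))
        (trans (sym (*-distribˡ-sumOver (weight b * t) (subsets n) _)) (*-assoc (weight b) t _)))

  𝔼-∏ : ∀ n (g : Fin n → Bool → Fin Λ → ℚ) →
    𝔼 n (λ A ψ → prodFin n (λ u → g u (A u) (ψ u))) ≡ prodFin n (λ u → 𝔼₁ (g u))
  𝔼-∏ zero    g = refl
  𝔼-∏ (suc n) g = begin
    𝔼 (suc n) (λ A ψ → prodFin (suc n) (λ u → g u (A u) (ψ u)))
      ≡⟨ 𝔼-suc n _ ⟩
    𝔼₁ (λ b k → 𝔼 n (λ A ψ → g zero b k * prodFin n (λ u → g (suc u) (A u) (ψ u))))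
      ≡⟨ 𝔼₁-cong (λ b k → 𝔼-*ˡ n (g zero b k) (λ A ψ → prodFin n (λ u → g (suc u) (A u) (ψ u)))) ⟩
    𝔼₁ (λ b k → g zero b k * 𝔼 n (λ A ψ → prodFin n (λ u → g (suc u) (A u) (ψ u))))
      ≡⟨ 𝔼₁-*ʳ (g zero) _ ⟩
    𝔼₁ (g zero) * 𝔼 n (λ A ψ → prodFin n (λ u → g (suc u) (A u) (ψ u)))
      ≡⟨ cong (𝔼₁ (g zero) *_) (𝔼-∏ n (λ u → g (suc u))) ⟩
    prodFin (suc n) (λ u → 𝔼₁ (g u)) ∎
    where open ≡-Reasoning

  𝔼-count : ∀ n k (N : Fin k → Bool) (Ev : Fin k → (Fin n → Bool) → (Fin n → Fin Λ) → Bool) Y →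
    (∀ u → N u ≡ true → 𝔼 n (λ A ψ → 𝟙 (Ev u A ψ)) ≡ Y) →
    𝔼 n (λ A ψ → fromℕ (count k (λ u → N u ∧ Ev u A ψ))) ≡ fromℕ (count k N) * Y
  𝔼-count n k N Ev Y 𝔼Ev≡Y = begin
    𝔼 n (λ A ψ → fromℕ (count k (λ u → N u ∧ Ev u A ψ)))
      ≡⟨ 𝔼-cong n (λ A ψ → sym (trans (sum-cong-≗ {k} (λ u → sym (𝟙-∧ (N u) (Ev u A ψ)))) (∑-𝟙 k _))) ⟩
    𝔼 n (λ A ψ → ∑[ u < k ] (𝟙 (N u) * 𝟙 (Ev u A ψ)))
      ≡⟨ 𝔼-∑ n k (λ u A ψ → 𝟙 (N u) * 𝟙 (Ev u A ψ)) ⟩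
    ∑[ u < k ] 𝔼 n (λ A ψ → 𝟙 (N u) * 𝟙 (Ev u A ψ))
      ≡⟨ sum-cong-≗ {k} (λ u → trans (𝔼-*ˡ n (𝟙 (N u)) _) (weighted u)) ⟩
    ∑[ u < k ] (𝟙 (N u) * Y)
      ≡⟨ sym (*-distribʳ-sum Y (λ u → 𝟙 (N u))) ⟩
    (∑[ u < k ] 𝟙 (N u)) * Y
      ≡⟨ cong (_* Y) (∑-𝟙 k N) ⟩
    fromℕ (count k N) * Y ∎
    where
    open ≡-Reasoning
    weighted : ∀ u → 𝟙 (N u) * 𝔼 n (λ A ψ → 𝟙 (Ev u A ψ)) ≡ 𝟙 (N u) * Y
    weighted u with N u in Nu
    ... | true  = cong (1ℚ *_) (𝔼Ev≡Y u Nu)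
    ... | false = trans (*-zeroˡ (𝔼 n (λ A ψ → 𝟙 (Ev u A ψ)))) (sym (*-zeroˡ Y))

  q : ℚ
  q = 1ℚ - p * t

  module Uniform (t*Λ≡1 : t * fromℕ Λ ≡ 1ℚ) where

    𝔼₁-1 : 𝔼₁ (λ _ _ → 1ℚ) ≡ 1ℚ
    𝔼₁-1 rewrite ∑-const Λ 1ℚ =
      trans (solve 3 (λ p t L → (con 1ℚ :- p) :* (t :* (L :* con 1ℚ)) :+ p :* (t :* (L :* con 1ℚ)) := t :* L)
               refl p t (fromℕ Λ))
            t*Λ≡1

    𝔼₁-active : 𝔼₁ (λ b _ → 𝟙 b) ≡ p
    𝔼₁-active rewrite ∑-const Λ 0ℚ | ∑-const Λ 1ℚ =
      trans (solve 3 (λ p t L → (con 1ℚ :- p) :* (t :* (L :* con 0ℚ)) :+ p :* (t :* (L :* con 1ℚ)) := p :* (t :* L))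
               refl p t (fromℕ Λ))
            (trans (cong (p *_) t*Λ≡1) (*-identityʳ p))

    𝔼₁-inactive : 𝔼₁ (λ b _ → 𝟙 (not b)) ≡ 1ℚ - p
    𝔼₁-inactive rewrite ∑-const Λ 0ℚ | ∑-const Λ 1ℚ =
      trans (solve 3 (λ p t L → (con 1ℚ :- p) :* (t :* (L :* con 1ℚ)) :+ p :* (t :* (L :* con 0ℚ))
                                := (con 1ℚ :- p) :* (t :* L))
               refl p t (fromℕ Λ))
            (trans (cong ((1ℚ - p) *_) t*Λ≡1) (*-identityʳ _))

    𝔼₁-active-at : ∀ k′ → 𝔼₁ (λ b k → 𝟙 (b ∧ does (k ≟ k′))) ≡ p * t
    𝔼₁-active-at k′
      rewrite ∑-const Λ 0ℚ
            | sum-cong-≗ {Λ} (λ k → trans (cong 𝟙 (does-≟-comm k k′)) (sym (*-identityʳ (𝟙 (does (k′ ≟ k))))))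
            | ∑-δ Λ k′ (λ _ → 1ℚ) =
      solve 3 (λ p t L → (con 1ℚ :- p) :* (t :* (L :* con 0ℚ)) :+ p :* (t :* con 1ℚ) := p :* t) refl p t (fromℕ Λ)

    𝔼₁-avoid : ∀ s (P : Fin Λ → Bool) → AtMostOne P →
      𝔼₁ (λ b k → 𝟙 (not (s ∧ (b ∧ P k)))) ≡ (if s ∧ anyFin Λ P then q else 1ℚ)
    𝔼₁-avoid false P unique = 𝔼₁-1
    𝔼₁-avoid true  P unique = begin
      (1ℚ - p) * (t * ∑[ k < Λ ] 1ℚ) + p * (t * ∑[ k < Λ ] 𝟙 (not (P k)))
        ≡⟨ cong₂ (λ x y → (1ℚ - p) * (t * x) + p * (t * y)) (∑-const Λ 1ℚ) (∑-𝟙-not Λ P) ⟩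
      (1ℚ - p) * (t * (fromℕ Λ * 1ℚ)) + p * (t * (fromℕ Λ - fromℕ (count Λ P)))
        ≡⟨ cong (λ c → (1ℚ - p) * (t * (fromℕ Λ * 1ℚ)) + p * (t * (fromℕ Λ - fromℕ c)))
                (count-atMostOne Λ P unique) ⟩
      (1ℚ - p) * (t * (fromℕ Λ * 1ℚ)) + p * (t * (fromℕ Λ - fromℕ (if anyFin Λ P then 1 else 0)))
        ≡⟨ evaluate (anyFin Λ P) ⟩
      (if anyFin Λ P then q else 1ℚ) ∎
      where
      open ≡-Reasoning
      evaluate : ∀ b → (1ℚ - p) * (t * (fromℕ Λ * 1ℚ)) + p * (t * (fromℕ Λ - fromℕ (if b then 1 else 0)))
                     ≡ (if b then q else 1ℚ)
      evaluate true  = trans (solve 3 (λ p t L → (con 1ℚ :- p) :* (t :* (L :* con 1ℚ)) :+ p :* (t :* (L :- con 1ℚ))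
                                                 := t :* L :- p :* t) refl p t (fromℕ Λ))
                             (cong (_- p * t) t*Λ≡1)
      evaluate false = trans (solve 3 (λ p t L → (con 1ℚ :- p) :* (t :* (L :* con 1ℚ)) :+ p :* (t :* (L :- con 0ℚ))
                                                 := t :* L) refl p t (fromℕ Λ))
                             t*Λ≡1

    𝔼-at : ∀ n u (g : Bool → Fin Λ → ℚ) (f : Fin n → Bool → Fin Λ → ℚ) → (∀ b k → f u b k ≡ 1ℚ) →
      𝔼 n (λ A ψ → g (A u) (ψ u) * prodFin n (λ w → f w (A w) (ψ w))) ≡ 𝔼₁ g * prodFin n (λ w → 𝔼₁ (f w))
    𝔼-at n u g f fu≡1 = begin
      𝔼 n (λ A ψ → g (A u) (ψ u) * prodFin n (λ w → f w (A w) (ψ w)))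
        ≡⟨ 𝔼-cong n (λ A ψ →
             sym (prodFin-update n u (λ w → f w (A w) (ψ w)) (λ w → g (A w) (ψ w)) (fu≡1 (A u) (ψ u)))) ⟩
      𝔼 n (λ A ψ → prodFin n (λ w → h w (A w) (ψ w)))
        ≡⟨ 𝔼-∏ n h ⟩
      prodFin n (λ w → 𝔼₁ (h w))
        ≡⟨ prodFin-cong n 𝔼₁-h ⟩
      prodFin n (λ w → if does (w ≟ u) then 𝔼₁ g else 𝔼₁ (f w))
        ≡⟨ prodFin-update n u (λ w → 𝔼₁ (f w)) (λ _ → 𝔼₁ g) (trans (𝔼₁-cong fu≡1) 𝔼₁-1) ⟩
      𝔼₁ g * prodFin n (λ w → 𝔼₁ (f w)) ∎
      where
      open ≡-Reasoning
      h : Fin n → Bool → Fin Λ → ℚ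
      h w b k = if does (w ≟ u) then g b k else f w b k
      𝔼₁-h : ∀ w → 𝔼₁ (h w) ≡ (if does (w ≟ u) then 𝔼₁ g else 𝔼₁ (f w))
      𝔼₁-h w with does (w ≟ u)
      ... | true  = refl
      ... | false = refl

    𝔼-coordinate : ∀ n u (g : Bool → Fin Λ → ℚ) → 𝔼 n (λ A ψ → g (A u) (ψ u)) ≡ 𝔼₁ g
    𝔼-coordinate n u g = begin
      𝔼 n (λ A ψ → g (A u) (ψ u))
        ≡⟨ 𝔼-cong n (λ A ψ → sym (trans (cong (g (A u) (ψ u) *_) (prodFin-1 n)) (*-identityʳ _))) ⟩
      𝔼 n (λ A ψ → g (A u) (ψ u) * prodFin n (λ _ → 1ℚ))
        ≡⟨ 𝔼-at n u g (λ _ _ _ → 1ℚ) (λ _ _ → refl) ⟩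
      𝔼₁ g * prodFin n (λ _ → 𝔼₁ (λ _ _ → 1ℚ))
        ≡⟨ cong (𝔼₁ g *_) (trans (prodFin-cong n (λ _ → 𝔼₁-1)) (prodFin-1 n)) ⟩
      𝔼₁ g * 1ℚ
        ≡⟨ *-identityʳ _ ⟩
      𝔼₁ g ∎
      where open ≡-Reasoning

module Expectations {n m C Λ D : ℕ} (VS : ValidSetting n m C Λ D) (p t : ℚ) (t*Λ≡1 : t * fromℕ Λ ≡ 1ℚ) where
  open ValidSetting VS
  open RandomPair Λ p t
  open Uniform t*Λ≡1

  adj-inGʳ : ∀ i u w → adj i w u ≡ true → inG i u ≡ true
  adj-inGʳ i u w wu = adj-inG i u w (trans (adj-sym i u w) wu)

  adj-outside : ∀ i u w → inG i u ≡ false → adj i w u ≡ false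
  adj-outside i u w u∉Gi = ¬-not (λ wu → not-¬ (adj-inGʳ i u w wu) u∉Gi)

  neighbour-outside : ∀ {i j} u w → i ≢ j → inG i u ≡ true → adj j w u ≡ true → inG i w ≡ false
  neighbour-outside {i} {j} u w i≢j u∈Gi wu = ¬-not λ w∈Gi →
    not-¬ (adj-irr j u) (subst (λ x → adj j x u ≡ true)
      (nearly-disjoint i j i≢j w u w∈Gi (adj-inG j w u wu) u∈Gi (adj-inGʳ j u w wu)) wu)

  adj-atMostOne : ∀ w u → AtMostOne (λ i → adj i w u)
  adj-atMostOne w u {i} {j} wu∈Gi wu∈Gj with i ≟ j
  ... | yes i≡j = i≡j
  ... | no  i≢j = ⊥-elim (not-¬ (adj-inG i w u wu∈Gi) (neighbour-outside u w i≢j (adj-inGʳ i u w wu∈Gi) wu∈Gj))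

  adjG-irrefl : ∀ u → adjG u u ≡ false
  adjG-irrefl u = ¬-not λ uu → let (i , uu∈Gi) = anyFin-witness m (λ i → adj i u u) uu in not-¬ uu∈Gi (adj-irr i u)

  colour-atMostOne : ∀ u c → AtMostOne (λ k → L u k ≡ᵇ c)
  colour-atMostOne u c ka kb = L-inj u _ _ (trans (≡ᵇ-true⇒≡ ka) (sym (≡ᵇ-true⇒≡ kb)))

  inL-L : ∀ u k → inL u (L u k) ≡ true
  inL-L u k = anyFin-intro Λ (λ j → L u j ≡ᵇ L u k) k (≡ᵇ-refl (L u k))

  inL-witness : ∀ u c → inL u c ≡ true → ∃ λ k → L u k ≡ c
  inL-witness u c c∈Lu = let (k , e) = anyFin-witness Λ (λ j → L u j ≡ᵇ c) c∈Lu in k , ≡ᵇ-true⇒≡ e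

  neighbours-in-Gj : ∀ j u k → count n (λ w → adj j w u ∧ inL w (L u k)) ≡ (if inG j u then D else 0)
  neighbours-in-Gj j u k with inG j u in u∈Gj
  ... | true  = trans (count-cong n (λ w → cong (_∧ inL w (L u k)) (adj-sym j w u))) (degD j u k u∈Gj)
  ... | false = count-none n _ (λ w → cong (_∧ inL w (L u k)) (adj-outside j u w u∈Gj))

  neighbours-with-colour : ∀ u k → count n (λ w → adjG w u ∧ inL w (L u k)) ≡ D ℕ.* C
  neighbours-with-colour u k = begin
    count n (λ w → adjG w u ∧ inL w (L u k))
      ≡⟨ count-cong n (λ w → anyFin-∧ʳ m (λ j → adj j w u) (inL w (L u k))) ⟩
    count n (λ w → anyFin m (λ j → adj j w u ∧ inL w (L u k)))
      ≡⟨ count-anyFin n m _ (λ j → inG j u) D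
           (λ w wj wj′ → adj-atMostOne w u (∧-conicalˡ _ _ wj) (∧-conicalˡ _ _ wj′))
           (λ j → neighbours-in-Gj j u k) ⟩
    D ℕ.* count m (λ j → inG j u)
      ≡⟨ cong (D ℕ.*_) (degC u) ⟩
    D ℕ.* C ∎
    where open ≡-Reasoning

  neighbours-in-Gj-outside-Gi : ∀ i j u k → inG i u ≡ true →
    count n (λ w → adj j w u ∧ (not (inG i w) ∧ inL w (L u k))) ≡ (if not (does (j ≟ i)) ∧ inG j u then D else 0)
  neighbours-in-Gj-outside-Gi i j u k u∈Gi with j ≟ i
  ... | yes refl = count-none n _ inside
    where
    inside : ∀ w → adj i w u ∧ (not (inG i w) ∧ inL w (L u k)) ≡ false
    inside w with adj i w u in wu
    ... | false = refl
    ... | true  rewrite adj-inG i w u wu = refl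
  ... | no j≢i = trans (count-cong n outside) (neighbours-in-Gj j u k)
    where
    outside : ∀ w → adj j w u ∧ (not (inG i w) ∧ inL w (L u k)) ≡ adj j w u ∧ inL w (L u k)
    outside w with adj j w u in wu
    ... | false = refl
    ... | true  rewrite neighbour-outside u w (λ i≡j → j≢i (sym i≡j)) u∈Gi wu = refl

  neighbours-with-colour-outside : ∀ i u k → inG i u ≡ true →
    count n (λ w → (not (inG i w) ∧ adjG w u) ∧ inL w (L u k)) ≡ D ℕ.* (C ∸ 1)
  neighbours-with-colour-outside i u k u∈Gi = begin
    count n (λ w → (not (inG i w) ∧ adjG w u) ∧ inL w (L u k))
      ≡⟨ count-cong n (λ w → trans (xy∧z≡y∧xz (not (inG i w)) _ _) (anyFin-∧ʳ m (λ j → adj j w u) _)) ⟩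
    count n (λ w → anyFin m (λ j → adj j w u ∧ (not (inG i w) ∧ inL w (L u k))))
      ≡⟨ count-anyFin n m _ (λ j → not (does (j ≟ i)) ∧ inG j u) D
           (λ w wj wj′ → adj-atMostOne w u (∧-conicalˡ _ _ wj) (∧-conicalˡ _ _ wj′))
           (λ j → neighbours-in-Gj-outside-Gi i j u k u∈Gi) ⟩
    D ℕ.* count m (λ j → not (does (j ≟ i)) ∧ inG j u)
      ≡⟨ cong (λ c → D ℕ.* (c ∸ 1)) (trans (sym (count-remove m (λ j → inG j u) i u∈Gi)) (degC u)) ⟩
    D ℕ.* (C ∸ 1) ∎
    where open ≡-Reasoning

  free : (Fin n → Bool) → ℕ → (Fin n → Bool) → (Fin n → Fin Λ) → Bool
  free B c A ψ = not (anyFin n (λ w → B w ∧ (A w ∧ (L w (ψ w) ≡ᵇ c))))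

  ∏-𝔼₁-avoid : ∀ (B : Fin n → Bool) c →
    prodFin n (λ w → 𝔼₁ (λ b k → 𝟙 (not (B w ∧ (b ∧ (L w k ≡ᵇ c)))))) ≡ q ^ℚ count n (λ w → B w ∧ inL w c)
  ∏-𝔼₁-avoid B c = trans (prodFin-cong n (λ w → 𝔼₁-avoid (B w) (λ k → L w k ≡ᵇ c) (colour-atMostOne w c)))
                         (prodFin-^ n (λ w → B w ∧ inL w c) q)

  𝔼-free : ∀ (B : Fin n → Bool) c → 𝔼 n (λ A ψ → 𝟙 (free B c A ψ)) ≡ q ^ℚ count n (λ w → B w ∧ inL w c)
  𝔼-free B c = begin
    𝔼 n (λ A ψ → 𝟙 (free B c A ψ))
      ≡⟨ 𝔼-cong n (λ A ψ → 𝟙-not-anyFin n (λ w → B w ∧ (A w ∧ (L w (ψ w) ≡ᵇ c)))) ⟩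
    𝔼 n (λ A ψ → prodFin n (λ w → 𝟙 (not (B w ∧ (A w ∧ (L w (ψ w) ≡ᵇ c))))))
      ≡⟨ 𝔼-∏ n (λ w b k → 𝟙 (not (B w ∧ (b ∧ (L w k ≡ᵇ c))))) ⟩
    prodFin n (λ w → 𝔼₁ (λ b k → 𝟙 (not (B w ∧ (b ∧ (L w k ≡ᵇ c))))))
      ≡⟨ ∏-𝔼₁-avoid B c ⟩
    q ^ℚ count n (λ w → B w ∧ inL w c) ∎
    where open ≡-Reasoning

  𝔼-at-free : ∀ (B : Fin n → Bool) c u (g : Bool → Fin Λ → ℚ) → B u ≡ false →
    𝔼 n (λ A ψ → g (A u) (ψ u) * 𝟙 (free B c A ψ)) ≡ 𝔼₁ g * q ^ℚ count n (λ w → B w ∧ inL w c)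
  𝔼-at-free B c u g u∉B = begin
    𝔼 n (λ A ψ → g (A u) (ψ u) * 𝟙 (free B c A ψ))
      ≡⟨ 𝔼-cong n (λ A ψ → cong (g (A u) (ψ u) *_) (𝟙-not-anyFin n (λ w → B w ∧ (A w ∧ (L w (ψ w) ≡ᵇ c))))) ⟩
    𝔼 n (λ A ψ → g (A u) (ψ u) * prodFin n (λ w → 𝟙 (not (B w ∧ (A w ∧ (L w (ψ w) ≡ᵇ c))))))
      ≡⟨ 𝔼-at n u g (λ w b k → 𝟙 (not (B w ∧ (b ∧ (L w k ≡ᵇ c)))))
                    (λ b k → cong (λ s → 𝟙 (not (s ∧ (b ∧ (L u k ≡ᵇ c))))) u∉B) ⟩
    𝔼₁ g * prodFin n (λ w → 𝔼₁ (λ b k → 𝟙 (not (B w ∧ (b ∧ (L w k ≡ᵇ c))))))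
      ≡⟨ cong (𝔼₁ g *_) (∏-𝔼₁-avoid B c) ⟩
    𝔼₁ g * q ^ℚ count n (λ w → B w ∧ inL w c) ∎
    where open ≡-Reasoning

  𝔼-R : ∀ v → 𝔼 n (λ A ψ → fromℕ (RV.R S A ψ v)) ≡ q ^ℚ (D ℕ.* C) * fromℕ Λ
  𝔼-R v = begin
    𝔼 n (λ A ψ → fromℕ (count Λ (λ k → inL v (L v k) ∧ free (λ u → adjG u v) (L v k) A ψ)))
      ≡⟨ 𝔼-count n Λ (λ k → inL v (L v k)) (λ k → free (λ u → adjG u v) (L v k)) (q ^ℚ (D ℕ.* C))
           (λ k _ → trans (𝔼-free (λ u → adjG u v) (L v k)) (cong (q ^ℚ_) (neighbours-with-colour v k))) ⟩
    fromℕ (count Λ (λ k → inL v (L v k))) * q ^ℚ (D ℕ.* C)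
      ≡⟨ cong (λ c → fromℕ c * q ^ℚ (D ℕ.* C)) (count-all Λ _ (inL-L v)) ⟩
    fromℕ Λ * q ^ℚ (D ℕ.* C)
      ≡⟨ *-comm (fromℕ Λ) _ ⟩
    q ^ℚ (D ℕ.* C) * fromℕ Λ ∎
    where open ≡-Reasoning

  𝔼-uncoloured : ∀ u → 𝔼 n (λ A ψ → 𝟙 (A u ∧ not (RV.inX S A ψ u))) ≡ p * (1ℚ - q ^ℚ (D ℕ.* C))
  𝔼-uncoloured u = begin
    𝔼 n (λ A ψ → 𝟙 (A u ∧ not (RV.inX S A ψ u)))
      ≡⟨ 𝔼-cong n split ⟩
    𝔼 n (λ A ψ → 𝟙 (A u) + (- 1ℚ) * ∑[ k′ < Λ ] G k′ A ψ)
      ≡⟨ trans (𝔼-+ n _ _) (cong (λ x → 𝔼 n (λ A ψ → 𝟙 (A u)) + x)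
                                  (trans (𝔼-*ˡ n (- 1ℚ) _) (cong ((- 1ℚ) *_) (𝔼-∑ n Λ G)))) ⟩
    𝔼 n (λ A ψ → 𝟙 (A u)) + (- 1ℚ) * ∑[ k′ < Λ ] 𝔼 n (G k′)
      ≡⟨ cong₂ (λ x y → x + (- 1ℚ) * y) (trans (𝔼-coordinate n u (λ b _ → 𝟙 b)) 𝔼₁-active)
                                         (trans (sum-cong-≗ {Λ} 𝔼G) (∑-const Λ _)) ⟩
    p + (- 1ℚ) * (fromℕ Λ * ((p * t) * Q))
      ≡⟨ solve 4 (λ p t L Q → p :+ con (- 1ℚ) :* (L :* ((p :* t) :* Q)) := p :* (con 1ℚ :- Q :* (t :* L)))
                 refl p t (fromℕ Λ) Q ⟩
    p * (1ℚ - Q * (t * fromℕ Λ))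
      ≡⟨ cong (λ x → p * (1ℚ - Q * x)) t*Λ≡1 ⟩
    p * (1ℚ - Q * 1ℚ)
      ≡⟨ cong (λ x → p * (1ℚ - x)) (*-identityʳ Q) ⟩
    p * (1ℚ - Q) ∎
    where
    open ≡-Reasoning
    Q : ℚ
    Q = q ^ℚ (D ℕ.* C)
    F : Fin Λ → (Fin n → Bool) → (Fin n → Fin Λ) → Bool
    F k′ = free (λ w → adjG w u) (L u k′)
    G : Fin Λ → (Fin n → Bool) → (Fin n → Fin Λ) → ℚ
    G k′ A ψ = 𝟙 (A u ∧ does (ψ u ≟ k′)) * 𝟙 (F k′ A ψ)
    -- Conditioning on ψ u = k′ fixes the colour u must keep, making each term a product over the vertices.
    split : ∀ A ψ → 𝟙 (A u ∧ not (RV.inX S A ψ u)) ≡ 𝟙 (A u) + (- 1ℚ) * ∑[ k′ < Λ ] G k′ A ψ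
    split A ψ = begin
      𝟙 (A u ∧ not (A u ∧ (inL u (L u (ψ u)) ∧ F (ψ u) A ψ)))
        ≡⟨ cong (λ x → 𝟙 (A u ∧ not (A u ∧ (x ∧ F (ψ u) A ψ)))) (inL-L u (ψ u)) ⟩
      𝟙 (A u ∧ not (A u ∧ F (ψ u) A ψ))
        ≡⟨ 𝟙-∧-not-∧ (A u) (F (ψ u) A ψ) ⟩
      𝟙 (A u) + (- 1ℚ) * (𝟙 (A u) * 𝟙 (F (ψ u) A ψ))
        ≡⟨ cong (λ x → 𝟙 (A u) + (- 1ℚ) * x) (sym (∑-δ Λ (ψ u) (λ k′ → 𝟙 (A u) * 𝟙 (F k′ A ψ)))) ⟩
      𝟙 (A u) + (- 1ℚ) * ∑[ k′ < Λ ] (𝟙 (does (ψ u ≟ k′)) * (𝟙 (A u) * 𝟙 (F k′ A ψ)))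
        ≡⟨ cong (λ x → 𝟙 (A u) + (- 1ℚ) * x) (sum-cong-≗ {Λ} regroup) ⟩
      𝟙 (A u) + (- 1ℚ) * ∑[ k′ < Λ ] G k′ A ψ ∎
      where
      regroup : ∀ k′ → 𝟙 (does (ψ u ≟ k′)) * (𝟙 (A u) * 𝟙 (F k′ A ψ)) ≡ G k′ A ψ
      regroup k′ rewrite 𝟙-∧ (A u) (does (ψ u ≟ k′)) =
        solve 3 (λ d a f → d :* (a :* f) := (a :* d) :* f) refl (𝟙 (does (ψ u ≟ k′))) (𝟙 (A u)) (𝟙 (F k′ A ψ))
    𝔼G : ∀ k′ → 𝔼 n (G k′) ≡ (p * t) * Q
    𝔼G k′ = trans (𝔼-at-free (λ w → adjG w u) (L u k′) u (λ b k → 𝟙 (b ∧ does (k ≟ k′))) (adjG-irrefl u))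
                  (cong₂ _*_ (𝔼₁-active-at k′) (cong (q ^ℚ_) (neighbours-with-colour u k′)))

  𝔼-U : ∀ i v k → inG i v ≡ true →
    𝔼 n (λ A ψ → fromℕ (RV.U S A ψ v (L v k) i)) ≡ p * ((1ℚ - q ^ℚ (D ℕ.* C)) * fromℕ D)
  𝔼-U i v k v∈Gi = begin
    𝔼 n (λ A ψ → fromℕ (RV.U S A ψ v (L v k) i))
      ≡⟨ 𝔼-cong n (λ A ψ → cong fromℕ (count-cong n (λ u → ∧-regroup (adj i v u) (A u) (inL u (L v k)) _))) ⟩
    𝔼 n (λ A ψ → fromℕ (count n (λ u → (adj i v u ∧ inL u (L v k)) ∧ (A u ∧ not (RV.inX S A ψ u)))))
      ≡⟨ 𝔼-count n n _ (λ u A ψ → A u ∧ not (RV.inX S A ψ u)) _ (λ u _ → 𝔼-uncoloured u) ⟩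
    fromℕ (count n (λ u → adj i v u ∧ inL u (L v k))) * (p * (1ℚ - q ^ℚ (D ℕ.* C)))
      ≡⟨ cong (λ d → fromℕ d * (p * (1ℚ - q ^ℚ (D ℕ.* C)))) (degD i v k v∈Gi) ⟩
    fromℕ D * (p * (1ℚ - q ^ℚ (D ℕ.* C)))
      ≡⟨ x*yz≡y*zx (fromℕ D) p _ ⟩
    p * ((1ℚ - q ^ℚ (D ℕ.* C)) * fromℕ D) ∎
    where open ≡-Reasoning

  unblocked : Fin m → Fin n → ℕ → (Fin n → Bool) → (Fin n → Fin Λ) → Bool
  unblocked i u c A ψ = not (anyFin n (λ w → A w ∧ not (inG i w) ∧ (L w (ψ w) ≡ᵇ c) ∧ adjG w u))

  𝔼-unblocked : ∀ i u c → inG i u ≡ true → inL u c ≡ true →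
    𝔼 n (λ A ψ → 𝟙 (not (A u) ∧ unblocked i u c A ψ)) ≡ (1ℚ - p) * q ^ℚ (D ℕ.* (C ∸ 1))
  𝔼-unblocked i u c u∈Gi c∈Lu with inL-witness u c c∈Lu
  ... | k , refl = begin
    𝔼 n (λ A ψ → 𝟙 (not (A u) ∧ unblocked i u (L u k) A ψ))
      ≡⟨ 𝔼-cong n (λ A ψ → trans (cong (λ b → 𝟙 (not (A u) ∧ b)) (unblocked≡free A ψ))
                                 (𝟙-∧ (not (A u)) (free B (L u k) A ψ))) ⟩
    𝔼 n (λ A ψ → 𝟙 (not (A u)) * 𝟙 (free B (L u k) A ψ))
      ≡⟨ 𝔼-at-free B (L u k) u (λ b _ → 𝟙 (not b)) (cong (λ x → not x ∧ adjG u u) u∈Gi) ⟩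
    𝔼₁ (λ b _ → 𝟙 (not b)) * q ^ℚ count n (λ w → B w ∧ inL w (L u k))
      ≡⟨ cong₂ (λ x c → x * q ^ℚ c) 𝔼₁-inactive (neighbours-with-colour-outside i u k u∈Gi) ⟩
    (1ℚ - p) * q ^ℚ (D ℕ.* (C ∸ 1)) ∎
    where
    open ≡-Reasoning
    B : Fin n → Bool
    B w = not (inG i w) ∧ adjG w u
    unblocked≡free : ∀ A ψ → unblocked i u (L u k) A ψ ≡ free B (L u k) A ψ
    unblocked≡free A ψ = cong not (anyFin-cong n λ w →
      trans (cong (A w ∧_) (x∧yz≡xz∧y (not (inG i w)) (L w (ψ w) ≡ᵇ L u k) (adjG w u)))
            (x∧yz≡y∧xz (A w) (B w) (L w (ψ w) ≡ᵇ L u k)))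

  𝔼-K : ∀ i v k → inG i v ≡ true →
    𝔼 n (λ A ψ → fromℕ (RV.K S A ψ v (L v k) i)) ≡ (1ℚ - p) * (q ^ℚ (D ℕ.* (C ∸ 1)) * fromℕ D)
  𝔼-K i v k v∈Gi = begin
    𝔼 n (λ A ψ → fromℕ (RV.K S A ψ v (L v k) i))
      ≡⟨ 𝔼-cong n (λ A ψ → cong fromℕ (count-cong n (λ u → ∧-regroup (adj i v u) (not (A u)) (inL u (L v k)) _))) ⟩
    𝔼 n (λ A ψ → fromℕ (count n (λ u → (adj i v u ∧ inL u (L v k)) ∧ (not (A u) ∧ unblocked i u (L v k) A ψ))))
      ≡⟨ 𝔼-count n n _ (λ u A ψ → not (A u) ∧ unblocked i u (L v k) A ψ) _
           (λ u vu → 𝔼-unblocked i u (L v k) (adj-inGʳ i u v (∧-conicalˡ _ _ vu)) (∧-conicalʳ _ _ vu)) ⟩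
    fromℕ (count n (λ u → adj i v u ∧ inL u (L v k))) * ((1ℚ - p) * q ^ℚ (D ℕ.* (C ∸ 1)))
      ≡⟨ cong (λ d → fromℕ d * ((1ℚ - p) * q ^ℚ (D ℕ.* (C ∸ 1)))) (degD i v k v∈Gi) ⟩
    fromℕ D * ((1ℚ - p) * q ^ℚ (D ℕ.* (C ∸ 1)))
      ≡⟨ x*yz≡y*zx (fromℕ D) (1ℚ - p) _ ⟩
    (1ℚ - p) * (q ^ℚ (D ℕ.* (C ∸ 1)) * fromℕ D) ∎
    where open ≡-Reasoning

lemma4p3 : (n m C Λ D : ℕ) .{{_ : NonZero Λ}} → 1 ≤ C → 1 ≤ D →
    (VS : ValidSetting n m C Λ D) → (p : ℚ) → 0ℚ ≤ℚ p → p ≤ℚ 1ℚ →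
    let open ValidSetting VS
        q = 1ℚ - (p * ((+ 1) / Λ))
    in ((v : Fin n) →
          expect n Λ p (λ A ψ → RV.R S A ψ v)
            ≡ (q ^ℚ (D Data.Nat.* C)) * fromℕ Λ)
     × ((i : Fin m) (v : Fin n) (k : Fin Λ) → inG i v ≡ true →
          (expect n Λ p (λ A ψ → RV.U S A ψ v (L v k) i)
             ≡ p * ((1ℚ - (q ^ℚ (D Data.Nat.* C))) * fromℕ D))
        × (expect n Λ p (λ A ψ → RV.K S A ψ v (L v k) i)
             ≡ (1ℚ - p) * ((q ^ℚ (D Data.Nat.* (C Data.Nat.∸ 1))) * fromℕ D)))
lemma4p3 n m C Λ D _ _ VS p _ _ = 𝔼-R , λ i v k v∈Gi → 𝔼-U i v k v∈Gi , 𝔼-K i v k v∈Gi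
  where open Expectations VS p ((+ 1) / Λ) (1/n*n≡1 Λ)
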